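{- Let $X$ be a finite set of alternatives with $|X|=m\geq 4$ and $N=\{1,\dots,n\}$ with $n\geq 3$. Let $\mathbf{D}$ be the set of profiles $u\in L(X)^N$ for which it is not true that $u(i)[1:2]=u(j)[1:2]$ for all individuals $i,j$. Then any social choice correspondence $G$ on $L(X)^N$ satisfying balancedness and top-2-only is constant on $\mathbf{D}$.
   Context: An ordering on $X$ is a strict linear order on $X$; $L(X)$ is the set of all orderings; for an ordering $r$, $r[1:2]$ denotes the unordered set of the alternatives in the top two ranks of $r$. A profile is $u=(u(1),\dots,u(n))\in L(X)^N$. A social choice correspondence is a map $G$ from $L(X)^N$ to non-empty subsets of $X$. $G$ satisfies top-2-only if $G(u)=G(u^*)$ whenever $u(i)[1:2]=u^*(i)[1:2]$ for all individuals $i$. Profile $v$ is constructed from $u$ by transposition pair $(x,y)$ via individuals $i$ and $j$ if at $u$, $x$ is immediately above $y$ in $u(i)$ and $y$ is immediately above $x$ in $u(j)$, and $v$ equals $u$ except that $x$ and $y$ are swapped in the orderings of $i$ and $j$. $G$ satisfies balancedness if $G(v)=G(u)$ whenever $v$ is constructed from $u$ by some transposition pair via some two individuals. -}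

module Defs where

open import Data.Nat using (ℕ; zero; suc; _≤_)
open import Data.Fin using (Fin; zero; suc; _≟_)
open import Data.Fin.Subset using (Subset; Nonempty)
open import Data.Vec using (Vec; lookup)
open import Data.Product using (Σ; ∃; ∃-syntax; _×_; _,_)
open import Relation.Binary.PropositionalEquality using (_≡_; _≢_)
open import Relation.Nullary using (¬_; yes; no)
open import Function.Definitions using (Injective)

-- An ordering (strict linear order on X) is
-- represented by its ranking: the vector listing the alternatives from
-- best (position 0) to worst (position m-1), with no repetitions
-- (hence a bijection ranks → alternatives).  The injectivity proof is
-- irrelevant so that two orderings are equal iff their rankings are.
record Ordering (m : ℕ) : Set where
  constructor ordering
  field
    ranking : Vec (Fin m) m
    .distinct : Injective _≡_ _≡_ (lookup ranking)
open Ordering public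

_at_ : ∀ {m} → Ordering m → Fin m → Fin m
r at k = lookup (ranking r) k

-- x belongs to r[1:2], the set of the top two alternatives of r
-- (requires m ≥ 2 to make sense; we phrase it via "rank of x is 0 or 1")
InTop2 : ∀ {m} → Ordering m → Fin m → Set
InTop2 {m} r x = ∃[ k ] (r at k ≡ x × Data.Fin.toℕ k Data.Nat.< 2)
  where import Data.Fin
        import Data.Nat

SameTop2 : ∀ {m} → Ordering m → Ordering m → Set
SameTop2 {m} r s = (x : Fin m) → (InTop2 r x → InTop2 s x) × (InTop2 s x → InTop2 r x)

Profile : ℕ → ℕ → Set
Profile m n = Fin n → Ordering m

SCC : ℕ → ℕ → Set
SCC m n = Profile m n → Σ (Subset m) Nonempty

chosen : ∀ {m n} → SCC m n → Profile m n → Subset m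
chosen G u = Data.Product.proj₁ (G u)
  where import Data.Product

Top2Only : ∀ {m n} → SCC m n → Set
Top2Only {m} {n} G = (u u* : Profile m n) →
  ((i : Fin n) → SameTop2 (u i) (u* i)) → chosen G u ≡ chosen G u*

ImmAbove : ∀ {m} → Ordering m → Fin m → Fin m → Set
ImmAbove {m} r x y = ∃[ k ] ∃[ k' ] (Data.Fin.toℕ k' ≡ suc (Data.Fin.toℕ k) × r at k ≡ x × r at k' ≡ y)
  where import Data.Fin

swapAlt : ∀ {m} → Fin m → Fin m → Fin m → Fin m
swapAlt x y z with z ≟ x
... | yes _ = y
... | no _ with z ≟ y
...   | yes _ = x
...   | no _ = z

Swapped : ∀ {m} → Fin m → Fin m → Ordering m → Ordering m → Set
Swapped {m} x y r s = (k : Fin m) → s at k ≡ swapAlt x y (r at k)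

ByTransposition : ∀ {m n} → Profile m n → Profile m n → Set
ByTransposition {m} {n} u v = ∃[ x ] ∃[ y ] ∃[ i ] ∃[ j ]
  ( ImmAbove (u i) x y × ImmAbove (u j) y x
  × Swapped x y (u i) (v i) × Swapped x y (u j) (v j)
  × ((l : Fin n) → l ≢ i → l ≢ j → v l ≡ u l))

Balanced : ∀ {m n} → SCC m n → Set
Balanced {m} {n} G = (u v : Profile m n) → ByTransposition u v → chosen G v ≡ chosen G u

InD : ∀ {m n} → Profile m n → Set
InD {m} {n} u = ¬ ((i j : Fin n) → SameTop2 (u i) (u j))

module Submission where

-- By top-2-only, G is a function F of the profile of top pairs.  A transposition
-- of x and y sitting just below a in individual i turns i's top pair {a, x} into
-- {a, y}; the partner j, who has y just above x, either keeps its top pair (when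
-- it is disjoint from {x, y}, or equal to it) or turns {b, y} into {b, x}.  By
-- balancedness F is invariant under these moves.  Acting on three individuals at a
-- time, and with at least four alternatives, the moves connect every triple of top
-- pairs that are not all equal to ({0, 1}, {2, 3}, {2, 3}).  A profile in D has such
-- a triple through individuals 0 and 1; after it is normalised, every other
-- individual is moved to {2, 3} through a triple of the same kind.

open import Defs
open import Data.Nat using (ℕ; zero; suc; _+_; _≤_; z≤n; s≤s)
open import Data.Fin using (Fin; zero; suc; _≟_; #_; _↑ˡ_)
open import Data.Fin.Properties using (any?; all?; ¬∀⟶∃¬; pigeonhole; ↑ˡ-injective)
import Data.Fin.Properties as Finₚ
open import Data.Fin.Subset using (Subset)
open import Data.List as List using (List)
open import Data.List.Membership.Propositional using (_∈_)
open import Data.List.Membership.Propositional.Properties using (∈-allFin)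
open import Data.List.Relation.Unary.Any using (here; there)
open import Data.Vec using (tabulate; lookup)
open import Data.Vec.Properties using (lookup∘tabulate)
open import Data.Vec.Functional using (Vector; []; _∷_; head; tail)
open import Data.Product using (∃; ∃₂; ∃-syntax; _×_; _,_; proj₁; proj₂)
open import Data.Sum using (_⊎_; inj₁; inj₂)
open import Data.Empty using (⊥; ⊥-elim)
import Data.Empty.Irrelevant as Irrelevant
open import Function using (_∘_; id; _↣_; mk↣; Injection)
open import Function.Construct.Composition using (_↣-∘_)
open import Function.Definitions using (Injective)
open import Relation.Binary.PropositionalEquality
open import Relation.Nullary using (¬_; ¬?; Dec; yes; no)
open import Relation.Nullary.Decidable using (_×-dec_)
open import Relation.Binary.Bundles using (Setoid)
import Relation.Binary.Reasoning.Setoid as SetoidReasoning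

module _ {A : Set} where

  -- Recursion on the index, unlike Data.Vec.Functional.updateAt, makes an update of
  -- a concrete vector such as ⟪ A ∣ B ∣ C ⟫ compute to a concrete vector.
  infixl 6 _[_≔_]
  _[_≔_] : ∀ {n} → Vector A n → Fin n → A → Vector A n
  xs [ zero ≔ v ] = v ∷ tail xs
  xs [ suc i ≔ v ] = head xs ∷ (tail xs [ i ≔ v ])

  [≔]-updates : ∀ {n} (xs : Vector A n) i v → (xs [ i ≔ v ]) i ≡ v
  [≔]-updates xs zero v = refl
  [≔]-updates xs (suc i) v = [≔]-updates (tail xs) i v

  [≔]-minimal : ∀ {n} (xs : Vector A n) {i j} v → j ≢ i → (xs [ i ≔ v ]) j ≡ xs j
  [≔]-minimal xs {zero} {zero} v j≢i = ⊥-elim (j≢i refl)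
  [≔]-minimal xs {zero} {suc j} v j≢i = refl
  [≔]-minimal xs {suc i} {zero} v j≢i = refl
  [≔]-minimal xs {suc i} {suc j} v j≢i = [≔]-minimal (tail xs) v (j≢i ∘ cong suc)

  [≔]-idle : ∀ {n} (xs : Vector A n) {i v} → xs i ≡ v → ∀ j → (xs [ i ≔ v ]) j ≡ xs j
  [≔]-idle xs {i} {v} xsᵢ≡v j with j ≟ i
  ... | yes refl = trans ([≔]-updates xs j v) (sym xsᵢ≡v)
  ... | no j≢i = [≔]-minimal xs v j≢i

  [≔]-pointwise : ∀ {n} (P : A → Set) {xs : Vector A n} {i v} → (∀ j → P (xs j)) → P v → ∀ j → P ((xs [ i ≔ v ]) j)
  [≔]-pointwise P {xs} {i} {v} P-xs P-v j with j ≟ i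
  ... | yes refl = subst P (sym ([≔]-updates xs j v)) P-v
  ... | no j≢i = subst P (sym ([≔]-minimal xs v j≢i)) (P-xs j)

module _ {n : ℕ} {A B : Set} (f : Vector A n → B) (f-cong : ∀ {q q′} → (∀ l → q l ≡ q′ l) → f q ≡ f q′)
         (c : Vector A n) (Invariant : Vector A n → Set)
         (invariant-update : ∀ {q} l → Invariant q → Invariant (q [ l ≔ c l ]))
         (step : ∀ {q} l → Invariant q → f q ≡ f (q [ l ≔ c l ])) where

  private
    overwrite : List (Fin n) → Vector A n → Vector A n
    overwrite List.[] q = q
    overwrite (l List.∷ ls) q = overwrite ls q [ l ≔ c l ]

    overwrite-invariant : ∀ ls {q} → Invariant q → Invariant (overwrite ls q)
    overwrite-invariant List.[] inv = inv
    overwrite-invariant (l List.∷ ls) inv = invariant-update l (overwrite-invariant ls inv)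

    overwrite-preserves : ∀ ls {q} → Invariant q → f q ≡ f (overwrite ls q)
    overwrite-preserves List.[] inv = refl
    overwrite-preserves (l List.∷ ls) inv = trans (overwrite-preserves ls inv) (step l (overwrite-invariant ls inv))

    overwrite-covers : ∀ {ls} q {r} → r ∈ ls → overwrite ls q r ≡ c r
    overwrite-covers {l List.∷ ls} q {r} r∈ with r ≟ l | r∈
    ... | yes refl | _ = [≔]-updates _ r (c r)
    ... | no r≢l | here r≡l = ⊥-elim (r≢l r≡l)
    ... | no r≢l | there r∈ls = trans ([≔]-minimal _ (c l) r≢l) (overwrite-covers q r∈ls)

  converge : ∀ {q} → Invariant q → f q ≡ f c
  converge {q} inv = trans (overwrite-preserves (List.allFin n) inv) (f-cong λ r → overwrite-covers q (∈-allFin r))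

module _ {m : ℕ} where

  swapAlt-left : (x y : Fin m) → swapAlt x y x ≡ y
  swapAlt-left x y with x ≟ x
  ... | yes _ = refl
  ... | no x≢x = ⊥-elim (x≢x refl)

  swapAlt-right : (x y : Fin m) → swapAlt x y y ≡ x
  swapAlt-right x y with y ≟ x
  ... | yes y≡x = y≡x
  ... | no _ with y ≟ y
  ...   | yes _ = refl
  ...   | no y≢y = ⊥-elim (y≢y refl)

  swapAlt-other : {x y z : Fin m} → z ≢ x → z ≢ y → swapAlt x y z ≡ z
  swapAlt-other {x} {y} {z} z≢x z≢y with z ≟ x
  ... | yes z≡x = ⊥-elim (z≢x z≡x)
  ... | no _ with z ≟ y
  ...   | yes z≡y = ⊥-elim (z≢y z≡y)
  ...   | no _ = refl

  swapAlt-involutive : (x y z : Fin m) → swapAlt x y (swapAlt x y z) ≡ z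
  swapAlt-involutive x y z with z ≟ x
  ... | yes refl = swapAlt-right z y
  ... | no z≢x with z ≟ y
  ...   | yes refl = swapAlt-left x z
  ...   | no z≢y = swapAlt-other z≢x z≢y

  swapAlt-injective : (x y : Fin m) → Injective _≡_ _≡_ (swapAlt x y)
  swapAlt-injective x y {z} {w} e =
    trans (sym (swapAlt-involutive x y z)) (trans (cong (swapAlt x y) e) (swapAlt-involutive x y w))

  fromRanking : (f : Fin m → Fin m) → .(Injective _≡_ _≡_ f) → Ordering m
  fromRanking f f-inj = ordering (tabulate f)
    (λ e → f-inj (trans (sym (lookup∘tabulate f _)) (trans e (lookup∘tabulate f _))))

  fromRanking-at : (f : Fin m → Fin m) .(f-inj : Injective _≡_ _≡_ f) (r : Fin m) → fromRanking f f-inj at r ≡ f r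
  fromRanking-at f f-inj r = lookup∘tabulate f r

  swapOrdering : Fin m → Fin m → Ordering m → Ordering m
  swapOrdering x y (ordering rk rk-inj) =
    fromRanking (swapAlt x y ∘ lookup rk) (λ e → rk-inj (swapAlt-injective x y e))

  swapOrdering-swapped : (x y : Fin m) (o : Ordering m) → Swapped x y o (swapOrdering x y o)
  swapOrdering-swapped x y (ordering rk rk-inj) =
    fromRanking-at (swapAlt x y ∘ lookup rk) (λ e → rk-inj (swapAlt-injective x y e))

  place : (Fin m → Fin m) → Fin m → Fin m → Fin m → Fin m
  place f r v = swapAlt (f r) v ∘ f

  place-injective : ∀ {f} r v → Injective _≡_ _≡_ f → Injective _≡_ _≡_ (place f r v)
  place-injective {f} r v f-inj = f-inj ∘ swapAlt-injective (f r) v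

  place-at : ∀ f r v → place f r v r ≡ v
  place-at f r v = swapAlt-left (f r) v

  place-keeps : ∀ f r r′ {v w} → Injective _≡_ _≡_ f → r′ ≢ r → f r′ ≡ w → w ≢ v → place f r v r′ ≡ w
  place-keeps f r r′ f-inj r′≢r refl w≢v = swapAlt-other (r′≢r ∘ f-inj) w≢v

-- Unordered pairs

infix 4 _≈_ _≉_
data _≈_ {A : Set} : A × A → A × A → Set where
  ≈-refl : ∀ {p} → p ≈ p
  ≈-swap : ∀ {a b} → (a , b) ≈ (b , a)

_≉_ : {A : Set} → A × A → A × A → Set
p ≉ q = ¬ p ≈ q

module _ {A : Set} where

  ≈-sym : {p q : A × A} → p ≈ q → q ≈ p
  ≈-sym ≈-refl = ≈-refl
  ≈-sym ≈-swap = ≈-swap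

  ≈-trans : {p q r : A × A} → p ≈ q → q ≈ r → p ≈ r
  ≈-trans ≈-refl q≈r = q≈r
  ≈-trans ≈-swap ≈-refl = ≈-swap
  ≈-trans ≈-swap ≈-swap = ≈-refl

  ≡⇒≈ : {p q : A × A} → p ≡ q → p ≈ q
  ≡⇒≈ refl = ≈-refl

  Proper : A × A → Set
  Proper (a , b) = a ≢ b

  ≈-proper : {p q : A × A} → p ≈ q → Proper p → Proper q
  ≈-proper ≈-refl = id
  ≈-proper ≈-swap a≢b = a≢b ∘ sym

module _ {m : ℕ} where

  _≈?_ : (p q : Fin m × Fin m) → Dec (p ≈ q)
  (a , b) ≈? (c , d) with a ≟ c | b ≟ d | a ≟ d | b ≟ c
  ... | yes refl | yes refl | _ | _ = yes ≈-refl
  ... | _ | _ | yes refl | yes refl = yes ≈-swap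
  ... | no a≢c | _ | no a≢d | _ = no λ { ≈-refl → a≢c refl ; ≈-swap → a≢d refl }
  ... | no a≢c | _ | _ | no b≢c = no λ { ≈-refl → a≢c refl ; ≈-swap → b≢c refl }
  ... | _ | no b≢d | no a≢d | _ = no λ { ≈-refl → b≢d refl ; ≈-swap → a≢d refl }
  ... | _ | no b≢d | _ | no b≢c = no λ { ≈-refl → b≢d refl ; ≈-swap → b≢c refl }

  infix 4 _∈ₚ_ _∉ₚ_ _#_
  _∈ₚ_ _∉ₚ_ : Fin m → Fin m × Fin m → Set
  z ∈ₚ p = ∃ λ z′ → p ≈ (z , z′)
  z ∉ₚ (a , b) = z ≢ a × z ≢ b

  locate : (z : Fin m) (p : Fin m × Fin m) → z ∈ₚ p ⊎ z ∉ₚ p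
  locate z (a , b) with z ≟ a | z ≟ b
  ... | yes refl | _ = inj₁ (b , ≈-refl)
  ... | no _ | yes refl = inj₁ (a , ≈-swap)
  ... | no z≢a | no z≢b = inj₂ (z≢a , z≢b)

  _#_ : Fin m × Fin m → Fin m × Fin m → Set
  p # (a , b) = a ∉ₚ p × b ∉ₚ p

  record Distinct₄ (a b c d : Fin m) : Set where
    constructor distinct₄
    field
      a≢b : a ≢ b
      a≢c : a ≢ c
      a≢d : a ≢ d
      b≢c : b ≢ c
      b≢d : b ≢ d
      c≢d : c ≢ d

  module _ {a b c d : Fin m} (D : Distinct₄ a b c d) where
    open Distinct₄ D

    distinct₄-swap₀₁ : Distinct₄ b a c d
    distinct₄-swap₀₁ = distinct₄ (a≢b ∘ sym) b≢c b≢d a≢c a≢d c≢d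

    distinct₄-swap₁₂ : Distinct₄ a c b d
    distinct₄-swap₁₂ = distinct₄ a≢c a≢b a≢d (b≢c ∘ sym) c≢d b≢d

    distinct₄-swap₂₃ : Distinct₄ a b d c
    distinct₄-swap₂₃ = distinct₄ a≢b a≢d a≢c b≢d b≢c (c≢d ∘ sym)

    distinct₄-blocks : Distinct₄ c d a b
    distinct₄-blocks = distinct₄ c≢d (a≢c ∘ sym) (b≢c ∘ sym) (a≢d ∘ sym) (b≢d ∘ sym) a≢b

    distinct₄⇒# : (a , b) # (c , d)
    distinct₄⇒# = ((a≢c ∘ sym) , (b≢c ∘ sym)) , ((a≢d ∘ sym) , (b≢d ∘ sym))

  #⇒distinct₄ : ∀ {a b c d} → a ≢ b → c ≢ d → (a , b) # (c , d) → Distinct₄ a b c d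
  #⇒distinct₄ a≢b c≢d ((c≢a , c≢b) , (d≢a , d≢b)) =
    distinct₄ a≢b (c≢a ∘ sym) (d≢a ∘ sym) (c≢b ∘ sym) (d≢b ∘ sym) c≢d

  distinct₄-≈ : ∀ {a b c d a′ b′ c′ d′} → (a , b) ≈ (a′ , b′) → (c , d) ≈ (c′ , d′) →
    Distinct₄ a b c d → Distinct₄ a′ b′ c′ d′
  distinct₄-≈ ≈-refl ≈-refl D = D
  distinct₄-≈ ≈-refl ≈-swap D = distinct₄-swap₂₃ D
  distinct₄-≈ ≈-swap ≈-refl D = distinct₄-swap₀₁ D
  distinct₄-≈ ≈-swap ≈-swap D = distinct₄-swap₂₃ (distinct₄-swap₀₁ D)

  ∉ₚ-cong : ∀ {z p q} → p ≈ q → z ∉ₚ p → z ∉ₚ q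
  ∉ₚ-cong ≈-refl z∉p = z∉p
  ∉ₚ-cong ≈-swap (z≢a , z≢b) = z≢b , z≢a

  #-intro : ∀ {a b p} → a ∉ₚ p → b ∉ₚ p → (a , b) # p
  #-intro (a≢e , a≢f) (b≢e , b≢f) = ((a≢e ∘ sym) , (b≢e ∘ sym)) , ((a≢f ∘ sym) , (b≢f ∘ sym))

  ∉-∈ : ∀ {z z′ p} → z ∉ₚ p → p ≈ (z , z′) → ⊥
  ∉-∈ (z≢a , _) ≈-refl = z≢a refl
  ∉-∈ (_ , z≢b) ≈-swap = z≢b refl

  #-∈ : ∀ {p q z} → p # q → z ∈ₚ p → z ∈ₚ q → ⊥
  #-∈ (z∉p , _) (_ , p≈) (_ , ≈-refl) = ∉-∈ z∉p p≈
  #-∈ (_ , z∉p) (_ , p≈) (_ , ≈-swap) = ∉-∈ z∉p p≈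

  data Placement (A B C : Fin m × Fin m) : Set where
    apart-from-first : A # C → Placement A B C
    apart-from-second : B # C → Placement A B C
    straddling : ∀ {α α′ γ γ′} → A ≈ (α , α′) → B ≈ (γ , γ′) → C ≈ (α , γ) → Placement A B C

  placement : ∀ {A B} C → A # B → Placement A B C
  placement {A} {B} (e , f) A#B with locate e A | locate f A | locate e B | locate f B
  ... | inj₂ e∉A | inj₂ f∉A | _ | _ = apart-from-first (e∉A , f∉A)
  ... | inj₁ (_ , A∋e) | _ | _ | inj₁ (_ , B∋f) = straddling A∋e B∋f ≈-refl
  ... | _ | inj₁ (_ , A∋f) | inj₁ (_ , B∋e) | _ = straddling A∋f B∋e ≈-swap
  ... | _ | _ | inj₂ e∉B | inj₂ f∉B = apart-from-second (e∉B , f∉B)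
  ... | inj₁ e∈A | _ | inj₁ e∈B | _ = ⊥-elim (#-∈ A#B e∈A e∈B)
  ... | _ | inj₁ f∈A | _ | inj₁ f∈B = ⊥-elim (#-∈ A#B f∈A f∈B)

involution : {A : Set} (σ : A → A) → (∀ s → σ (σ s) ≡ s) → A ↣ A
involution σ σσ≡id = mk↣ {to = σ} λ {s} {s′} e → trans (sym (σσ≡id s)) (trans (cong σ e) (σσ≡id s′))

σ₀₁ σ₁₂ : Fin 3 → Fin 3
σ₀₁ zero = suc zero
σ₀₁ (suc zero) = zero
σ₀₁ (suc (suc s)) = suc (suc s)
σ₁₂ zero = zero
σ₁₂ (suc zero) = suc (suc zero)
σ₁₂ (suc (suc zero)) = suc zero

σ₀₁-involutive : ∀ s → σ₀₁ (σ₀₁ s) ≡ s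
σ₀₁-involutive zero = refl
σ₀₁-involutive (suc zero) = refl
σ₀₁-involutive (suc (suc s)) = refl

σ₁₂-involutive : ∀ s → σ₁₂ (σ₁₂ s) ≡ s
σ₁₂-involutive zero = refl
σ₁₂-involutive (suc zero) = refl
σ₁₂-involutive (suc (suc zero)) = refl

module Orderings (k : ℕ) where

  X : Set
  X = Fin (4 + k)

  ρ₀ ρ₁ ρ₂ ρ₃ : X
  ρ₀ = # 0
  ρ₁ = # 1
  ρ₂ = # 2
  ρ₃ = # 3

  top : Ordering (4 + k) → X × X
  top o = (o at ρ₀ , o at ρ₁)

  top-proper : (o : Ordering (4 + k)) → Proper (top o)
  top-proper (ordering rk rk-inj) e = Irrelevant.⊥-elim (ρ₀≢ρ₁ (rk-inj e))
    where
    ρ₀≢ρ₁ : ρ₀ ≢ ρ₁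
    ρ₀≢ρ₁ ()

  private
    inTop2⇒∈ : (o : Ordering (4 + k)) {x : X} → InTop2 o x → x ≡ o at ρ₀ ⊎ x ≡ o at ρ₁
    inTop2⇒∈ o (zero , refl , _) = inj₁ refl
    inTop2⇒∈ o (suc zero , refl , _) = inj₂ refl
    inTop2⇒∈ o (suc (suc r) , _ , s≤s (s≤s ()))

    ∈⇒inTop2 : (o : Ordering (4 + k)) {x : X} → x ≡ o at ρ₀ ⊎ x ≡ o at ρ₁ → InTop2 o x
    ∈⇒inTop2 o (inj₁ e) = ρ₀ , sym e , s≤s z≤n
    ∈⇒inTop2 o (inj₂ e) = ρ₁ , sym e , s≤s (s≤s z≤n)

    ≈-∈ : {p q : X × X} {x : X} → p ≈ q → x ≡ proj₁ p ⊎ x ≡ proj₂ p → x ≡ proj₁ q ⊎ x ≡ proj₂ q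
    ≈-∈ ≈-refl = id
    ≈-∈ ≈-swap (inj₁ e) = inj₂ e
    ≈-∈ ≈-swap (inj₂ e) = inj₁ e

  ≈⇒SameTop2 : (o o′ : Ordering (4 + k)) → top o ≈ top o′ → SameTop2 o o′
  ≈⇒SameTop2 o o′ o≈o′ x =
    (∈⇒inTop2 o′ ∘ ≈-∈ o≈o′ ∘ inTop2⇒∈ o) , (∈⇒inTop2 o ∘ ≈-∈ (≈-sym o≈o′) ∘ inTop2⇒∈ o′)

  rank₂ : X → X → X → X
  rank₂ a b = place (place id ρ₀ a) ρ₁ b

  rank₃ : X → X → X → X → X
  rank₃ a b c = place (rank₂ a b) ρ₂ c

  rank₄ : X → X → X → X → X → X
  rank₄ a b c d = place (rank₃ a b c) ρ₃ d

  rank₂-injective : ∀ a b → Injective _≡_ _≡_ (rank₂ a b)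
  rank₂-injective a b = place-injective ρ₁ b (place-injective ρ₀ a id)

  rank₃-injective : ∀ a b c → Injective _≡_ _≡_ (rank₃ a b c)
  rank₃-injective a b c = place-injective ρ₂ c (rank₂-injective a b)

  rank₄-injective : ∀ a b c d → Injective _≡_ _≡_ (rank₄ a b c d)
  rank₄-injective a b c d = place-injective ρ₃ d (rank₃-injective a b c)

  ordering₂ : X → X → Ordering (4 + k)
  ordering₂ a b = fromRanking (rank₂ a b) (rank₂-injective a b)

  ordering₃ : X → X → X → Ordering (4 + k)
  ordering₃ a b c = fromRanking (rank₃ a b c) (rank₃-injective a b c)

  ordering₄ : X → X → X → X → Ordering (4 + k)
  ordering₄ a b c d = fromRanking (rank₄ a b c d) (rank₄-injective a b c d)

  ordering₂-ρ₀ : ∀ a b → a ≢ b → ordering₂ a b at ρ₀ ≡ a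
  ordering₂-ρ₀ a b = place-keeps (place id ρ₀ a) ρ₁ ρ₀ (place-injective ρ₀ a id) (λ ()) (place-at id ρ₀ a)

  ordering₂-ρ₁ : ∀ a b → ordering₂ a b at ρ₁ ≡ b
  ordering₂-ρ₁ a b = place-at (place id ρ₀ a) ρ₁ b

  ordering₃-ρ₀ : ∀ a b c → a ≢ b → a ≢ c → ordering₃ a b c at ρ₀ ≡ a
  ordering₃-ρ₀ a b c a≢b = place-keeps (rank₂ a b) ρ₂ ρ₀ (rank₂-injective a b) (λ ()) (ordering₂-ρ₀ a b a≢b)

  ordering₃-ρ₁ : ∀ a b c → b ≢ c → ordering₃ a b c at ρ₁ ≡ b
  ordering₃-ρ₁ a b c = place-keeps (rank₂ a b) ρ₂ ρ₁ (rank₂-injective a b) (λ ()) (ordering₂-ρ₁ a b)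

  ordering₃-ρ₂ : ∀ a b c → ordering₃ a b c at ρ₂ ≡ c
  ordering₃-ρ₂ a b c = place-at (rank₂ a b) ρ₂ c

  ordering₄-ρ₀ : ∀ a b c d → a ≢ b → a ≢ c → a ≢ d → ordering₄ a b c d at ρ₀ ≡ a
  ordering₄-ρ₀ a b c d a≢b a≢c =
    place-keeps (rank₃ a b c) ρ₃ ρ₀ (rank₃-injective a b c) (λ ()) (ordering₃-ρ₀ a b c a≢b a≢c)

  ordering₄-ρ₁ : ∀ a b c d → b ≢ c → b ≢ d → ordering₄ a b c d at ρ₁ ≡ b
  ordering₄-ρ₁ a b c d b≢c =
    place-keeps (rank₃ a b c) ρ₃ ρ₁ (rank₃-injective a b c) (λ ()) (ordering₃-ρ₁ a b c b≢c)

  ordering₄-ρ₂ : ∀ a b c d → c ≢ d → ordering₄ a b c d at ρ₂ ≡ c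
  ordering₄-ρ₂ a b c d = place-keeps (rank₃ a b c) ρ₃ ρ₂ (rank₃-injective a b c) (λ ()) (ordering₃-ρ₂ a b c)

  ordering₄-ρ₃ : ∀ a b c d → ordering₄ a b c d at ρ₃ ≡ d
  ordering₄-ρ₃ a b c d = place-at (rank₃ a b c) ρ₃ d

  ordering₂-top : ∀ a b → a ≢ b → top (ordering₂ a b) ≡ (a , b)
  ordering₂-top a b a≢b = cong₂ _,_ (ordering₂-ρ₀ a b a≢b) (ordering₂-ρ₁ a b)

  ordering₃-top : ∀ a b c → a ≢ b → a ≢ c → b ≢ c → top (ordering₃ a b c) ≡ (a , b)
  ordering₃-top a b c a≢b a≢c b≢c = cong₂ _,_ (ordering₃-ρ₀ a b c a≢b a≢c) (ordering₃-ρ₁ a b c b≢c)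

  ordering₄-top : ∀ a b c d → a ≢ b → a ≢ c → a ≢ d → b ≢ c → b ≢ d → top (ordering₄ a b c d) ≡ (a , b)
  ordering₄-top a b c d a≢b a≢c a≢d b≢c b≢d =
    cong₂ _,_ (ordering₄-ρ₀ a b c d a≢b a≢c a≢d) (ordering₄-ρ₁ a b c d b≢c b≢d)

  ordering₂-above : ∀ a b → a ≢ b → ImmAbove (ordering₂ a b) a b
  ordering₂-above a b a≢b = ρ₀ , ρ₁ , refl , ordering₂-ρ₀ a b a≢b , ordering₂-ρ₁ a b

  ordering₃-above : ∀ a b c → b ≢ c → ImmAbove (ordering₃ a b c) b c
  ordering₃-above a b c b≢c = ρ₁ , ρ₂ , refl , ordering₃-ρ₁ a b c b≢c , ordering₃-ρ₂ a b c

  ordering₄-above : ∀ a b c d → c ≢ d → ImmAbove (ordering₄ a b c d) c d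
  ordering₄-above a b c d c≢d = ρ₂ , ρ₃ , refl , ordering₄-ρ₂ a b c d c≢d , ordering₄-ρ₃ a b c d

  top-swapOrdering : ∀ x y o {a b} → top o ≡ (a , b) → top (swapOrdering x y o) ≡ (swapAlt x y a , swapAlt x y b)
  top-swapOrdering x y o refl =
    cong₂ _,_ (swapOrdering-swapped x y o ρ₀) (swapOrdering-swapped x y o ρ₁)

  private
    among : (a b c d : X) → ¬ (d ≢ a × d ≢ b × d ≢ c) → ∃ λ s → (a ∷ b ∷ c ∷ []) s ≡ d
    among a b c d d-hits with d ≟ a | d ≟ b | d ≟ c
    ... | yes refl | _ | _ = zero , refl
    ... | no _ | yes refl | _ = suc zero , refl
    ... | no _ | no _ | yes refl = suc (suc zero) , refl
    ... | no d≢a | no d≢b | no d≢c = ⊥-elim (d-hits (d≢a , d≢b , d≢c))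

  fourth : (a b c : X) → ∃[ d ] (d ≢ a × d ≢ b × d ≢ c)
  fourth a b c with any? (λ t → ¬? (t ↑ˡ k ≟ a) ×-dec ¬? (t ↑ˡ k ≟ b) ×-dec ¬? (t ↑ˡ k ≟ c))
  ... | yes (t , t-avoids) = t ↑ˡ k , t-avoids
  ... | no none with pigeonhole (s≤s (s≤s (s≤s (s≤s z≤n)))) (λ t → proj₁ (among a b c (t ↑ˡ k) (none ∘ (t ,_))))
  ...   | t , t′ , t<t′ , same-position = ⊥-elim (Finₚ.<-irrefl (↑ˡ-injective k t t′ t≡t′) t<t′)
    where
    position : ∀ t → ∃ λ s → (a ∷ b ∷ c ∷ []) s ≡ t ↑ˡ k
    position t = among a b c (t ↑ˡ k) (none ∘ (t ,_))
    t≡t′ : t ↑ˡ k ≡ t′ ↑ˡ k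
    t≡t′ = trans (sym (proj₂ (position t))) (trans (cong (a ∷ b ∷ c ∷ []) same-position) (proj₂ (position t′)))

module Constancy (k n′ : ℕ) (G : SCC (4 + k) (3 + n′)) (balanced : Balanced G) (top2only : Top2Only G) where

  open Orderings k

  I : Set
  I = Fin (3 + n′)

  PairProfile : Set
  PairProfile = I → X × X

  realize : X × X → Ordering (4 + k)
  realize (a , b) = ordering₂ a b

  F : PairProfile → Subset (4 + k)
  F q = chosen G (realize ∘ q)

  top-realize : {p : X × X} → Proper p → top (realize p) ≡ p
  top-realize {a , b} a≢b = ordering₂-top a b a≢b

  ≈-top-realize : (o : Ordering (4 + k)) {p : X × X} → top o ≈ p → top o ≈ top (realize p)
  ≈-top-realize o o≈p = ≈-trans o≈p (≡⇒≈ (sym (top-realize (≈-proper o≈p (top-proper o)))))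

  realize-cong : {p q : X × X} → p ≈ q → top (realize p) ≈ top (realize q)
  realize-cong ≈-refl = ≈-refl
  realize-cong (≈-swap {a} {b}) with a ≟ b
  ... | yes refl = ≈-refl
  ... | no a≢b = subst₂ _≈_ (sym (ordering₂-top a b a≢b)) (sym (ordering₂-top b a (a≢b ∘ sym))) ≈-swap

  chosen-cong : {u v : Profile (4 + k) (3 + n′)} → (∀ l → top (u l) ≈ top (v l)) → chosen G u ≡ chosen G v
  chosen-cong {u} {v} u≈v = top2only u v (λ l → ≈⇒SameTop2 (u l) (v l) (u≈v l))

  chosen≡F : (u : Profile (4 + k) (3 + n′)) → chosen G u ≡ F (top ∘ u)
  chosen≡F u = chosen-cong {u} {realize ∘ top ∘ u} (λ l → ≈-top-realize (u l) ≈-refl)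

  F-cong : {p q : PairProfile} → (∀ l → p l ≈ q l) → F p ≡ F q
  F-cong {p} {q} p≈q = chosen-cong {realize ∘ p} {realize ∘ q} (λ l → realize-cong (p≈q l))

  F-transposition : {p q : PairProfile} {i j : I} {x y : X} (Oᵢ Oⱼ : Ordering (4 + k)) → i ≢ j →
    ImmAbove Oᵢ x y → ImmAbove Oⱼ y x → top Oᵢ ≈ p i → top Oⱼ ≈ p j →
    top (swapOrdering x y Oᵢ) ≈ q i → top (swapOrdering x y Oⱼ) ≈ q j →
    (∀ l → l ≢ i → l ≢ j → q l ≡ p l) → F p ≡ F q
  F-transposition {p} {q} {i} {j} {x} {y} Oᵢ Oⱼ i≢j Oᵢ-xy Oⱼ-yx Oᵢ≈pᵢ Oⱼ≈pⱼ Oᵢ′≈qᵢ Oⱼ′≈qⱼ q≡p =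
    begin
      F p         ≡⟨ chosen-cong {u} {realize ∘ p} (tops p Oᵢ≈pᵢ Oⱼ≈pⱼ (λ _ _ _ → refl)) ⟨
      chosen G u  ≡⟨ balanced u v transposition ⟨
      chosen G v  ≡⟨ chosen-cong {v} {realize ∘ q} (tops q Oᵢ′≈qᵢ Oⱼ′≈qⱼ q≡p) ⟩
      F q         ∎
    where
    open ≡-Reasoning

    with-pair : Ordering (4 + k) → Ordering (4 + k) → Profile (4 + k) (3 + n′)
    with-pair O O′ = (realize ∘ p) [ i ≔ O ] [ j ≔ O′ ]

    with-pair-i : ∀ O O′ → with-pair O O′ i ≡ O
    with-pair-i O O′ = trans ([≔]-minimal _ O′ i≢j) ([≔]-updates _ i O)

    with-pair-j : ∀ O O′ → with-pair O O′ j ≡ O′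
    with-pair-j O O′ = [≔]-updates _ j O′

    with-pair-other : ∀ O O′ {l} → l ≢ i → l ≢ j → with-pair O O′ l ≡ realize (p l)
    with-pair-other O O′ l≢i l≢j = trans ([≔]-minimal _ O′ l≢j) ([≔]-minimal _ O l≢i)

    u v : Profile (4 + k) (3 + n′)
    u = with-pair Oᵢ Oⱼ
    v = with-pair (swapOrdering x y Oᵢ) (swapOrdering x y Oⱼ)

    tops : ∀ {O O′} r → top O ≈ r i → top O′ ≈ r j → (∀ l → l ≢ i → l ≢ j → r l ≡ p l) →
      ∀ l → top (with-pair O O′ l) ≈ top (realize (r l))
    tops {O} {O′} r O≈rᵢ O′≈rⱼ r≡p l with l ≟ i | l ≟ j
    ... | yes refl | _ = subst (λ o → top o ≈ top (realize (r i))) (sym (with-pair-i O O′)) (≈-top-realize O O≈rᵢ)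
    ... | no _ | yes refl = subst (λ o → top o ≈ top (realize (r j))) (sym (with-pair-j O O′)) (≈-top-realize O′ O′≈rⱼ)
    ... | no l≢i | no l≢j = subst₂ (λ o s → top o ≈ top (realize s))
          (sym (with-pair-other O O′ l≢i l≢j)) (sym (r≡p l l≢i l≢j)) ≈-refl

    transposition : ByTransposition u v
    transposition = x , y , i , j ,
      subst (λ o → ImmAbove o x y) (sym (with-pair-i Oᵢ Oⱼ)) Oᵢ-xy ,
      subst (λ o → ImmAbove o y x) (sym (with-pair-j Oᵢ Oⱼ)) Oⱼ-yx ,
      subst₂ (Swapped x y) (sym (with-pair-i _ _)) (sym (with-pair-i _ _)) (swapOrdering-swapped x y Oᵢ) ,
      subst₂ (Swapped x y) (sym (with-pair-j _ _)) (sym (with-pair-j _ _)) (swapOrdering-swapped x y Oⱼ) ,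
      λ l l≢i l≢j → trans (with-pair-other _ _ l≢i l≢j) (sym (with-pair-other _ _ l≢i l≢j))

  -- Configurations of three individuals

  Trio : Set
  Trio = Fin 3 ↣ I

  member : Trio → Fin 3 → I
  member = Injection.to

  Configuration : Set
  Configuration = Vector (X × X) 3

  ⟪_∣_∣_⟫ : X × X → X × X → X × X → Configuration
  ⟪ A ∣ B ∣ C ⟫ = A ∷ B ∷ C ∷ []

  T U : X × X
  T = (# 0 , # 1)
  U = (# 2 , # 3)

  T≉U : T ≉ U
  T≉U ()

  twin : X × X → X × X → Configuration
  twin A B = ⟪ A ∣ B ∣ B ⟫

  canonical : Configuration
  canonical = twin T U

  canonical-proper : ∀ s → Proper (canonical s)
  canonical-proper zero ()
  canonical-proper (suc zero) ()
  canonical-proper (suc (suc zero)) ()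

  module Background (p : PairProfile) where

    fill : Trio → Configuration → PairProfile
    fill τ t l with any? (λ s → member τ s ≟ l)
    ... | yes (s , _) = t s
    ... | no _ = p l

    fill-member : ∀ τ t {s l} → member τ s ≡ l → fill τ t l ≡ t s
    fill-member τ t {s} {l} τs≡l with any? (λ s → member τ s ≟ l)
    ... | yes (s′ , τs′≡l) = cong t (Injection.injective τ (trans τs′≡l (sym τs≡l)))
    ... | no none = ⊥-elim (none (s , τs≡l))

    fill-nonmember : ∀ τ t {l} → (∀ s → member τ s ≢ l) → fill τ t l ≡ p l
    fill-nonmember τ t {l} l∉τ with any? (λ s → member τ s ≟ l)
    ... | yes (s , τs≡l) = ⊥-elim (l∉τ s τs≡l)
    ... | no _ = refl

    fill-≈ : ∀ τ {t t′} → (∀ s → t s ≈ t′ s) → ∀ l → fill τ t l ≈ fill τ t′ l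
    fill-≈ τ t≈t′ l with any? (λ s → member τ s ≟ l)
    ... | yes (s , _) = t≈t′ s
    ... | no _ = ≈-refl

    Ψ : Trio → Configuration → Subset (4 + k)
    Ψ τ t = F (fill τ t)

    Ψ-permute : ∀ τ σ (σσ≡id : ∀ s → σ (σ s) ≡ s) {t t′} → (∀ s → t s ≡ t′ (σ s)) →
      Ψ τ t ≡ Ψ (τ ↣-∘ involution σ σσ≡id) t′
    Ψ-permute τ σ σσ≡id {t} {t′} t≡t′σ = F-cong (λ l → ≡⇒≈ (fill-permuted l))
      where
      fill-permuted : ∀ l → fill τ t l ≡ fill (τ ↣-∘ involution σ σσ≡id) t′ l
      fill-permuted l with any? (λ s → member τ s ≟ l)
      ... | yes (s , τs≡l) =
            trans (t≡t′σ s) (sym (fill-member (τ ↣-∘ involution σ σσ≡id) t′ (trans (cong (member τ) (σσ≡id s)) τs≡l)))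
      ... | no l∉τ = sym (fill-nonmember (τ ↣-∘ involution σ σσ≡id) t′ (λ s → l∉τ ∘ (σ s ,_)))

    Ψ-transposition : ∀ τ {t t′ : Configuration} {s w : Fin 3} {x y : X} (Oₛ Oᵥ : Ordering (4 + k)) → s ≢ w →
      ImmAbove Oₛ x y → ImmAbove Oᵥ y x → top Oₛ ≈ t s → top Oᵥ ≈ t w →
      top (swapOrdering x y Oₛ) ≈ t′ s → top (swapOrdering x y Oᵥ) ≈ t′ w →
      (∀ r → r ≢ s → r ≢ w → t′ r ≡ t r) → Ψ τ t ≡ Ψ τ t′
    Ψ-transposition τ {t} {t′} {s} {w} {x} {y} Oₛ Oᵥ s≢w Oₛ-xy Oᵥ-yx Oₛ≈tₛ Oᵥ≈tᵥ Oₛ′≈t′ₛ Oᵥ′≈t′ᵥ t′≡t =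
      F-transposition Oₛ Oᵥ (s≢w ∘ Injection.injective τ) Oₛ-xy Oᵥ-yx
        (at-member t Oₛ Oₛ≈tₛ) (at-member t Oᵥ Oᵥ≈tᵥ)
        (at-member t′ (swapOrdering x y Oₛ) Oₛ′≈t′ₛ) (at-member t′ (swapOrdering x y Oᵥ) Oᵥ′≈t′ᵥ) agree
      where
      at-member : ∀ u O {r} → top O ≈ u r → top O ≈ fill τ u (member τ r)
      at-member u O {r} O≈uᵣ = subst (top O ≈_) (sym (fill-member τ u refl)) O≈uᵣ
      agree : ∀ l → l ≢ member τ s → l ≢ member τ w → fill τ t′ l ≡ fill τ t l
      agree l l≢τs l≢τw with any? (λ r → member τ r ≟ l)
      ... | yes (r , refl) = t′≡t r (l≢τs ∘ cong (member τ)) (l≢τw ∘ cong (member τ))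
      ... | no _ = refl

    -- A record, so that unification never unfolds Ψ.
    infix 4 _∼_
    record _∼_ (t t′ : Configuration) : Set where
      constructor equivalent
      field
        Ψ-equal : ∀ τ → Ψ τ t ≡ Ψ τ t′
    open _∼_ public

    ∼-refl : ∀ {t} → t ∼ t
    ∼-refl = equivalent λ _ → refl

    ∼-sym : ∀ {t t′} → t ∼ t′ → t′ ∼ t
    ∼-sym (equivalent t≡t′) = equivalent (sym ∘ t≡t′)

    ∼-trans : ∀ {t t′ t″} → t ∼ t′ → t′ ∼ t″ → t ∼ t″
    ∼-trans (equivalent t≡t′) (equivalent t′≡t″) = equivalent λ τ → trans (t≡t′ τ) (t′≡t″ τ)

    configurations : Setoid _ _
    configurations = record
      { Carrier = Configuration
      ; _≈_ = _∼_
      ; isEquivalence = record { refl = ∼-refl ; sym = ∼-sym ; trans = ∼-trans }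
      }

    ∼-cong : ∀ {A B C A′ B′ C′} → A ≈ A′ → B ≈ B′ → C ≈ C′ → ⟪ A ∣ B ∣ C ⟫ ∼ ⟪ A′ ∣ B′ ∣ C′ ⟫
    ∼-cong A≈A′ B≈B′ C≈C′ = equivalent λ τ →
      F-cong (fill-≈ τ λ { zero → A≈A′ ; (suc zero) → B≈B′ ; (suc (suc zero)) → C≈C′ })

    ∼-permute : ∀ σ (σσ≡id : ∀ s → σ (σ s) ≡ s) {t u t′ u′} → (∀ s → t′ s ≡ t (σ s)) → (∀ s → u′ s ≡ u (σ s)) →
      t ∼ u → t′ ∼ u′
    ∼-permute σ σσ≡id {t} {u} {t′} {u′} t′≡tσ u′≡uσ t∼u = equivalent λ τ →
      trans (Ψ-permute τ σ σσ≡id {t′} {t} t′≡tσ)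
            (trans (Ψ-equal t∼u (τ ↣-∘ involution σ σσ≡id)) (sym (Ψ-permute τ σ σσ≡id {u′} {u} u′≡uσ)))

    ∼-swap₀₁ : ∀ {A B C A′ B′ C′} → ⟪ A ∣ B ∣ C ⟫ ∼ ⟪ A′ ∣ B′ ∣ C′ ⟫ → ⟪ B ∣ A ∣ C ⟫ ∼ ⟪ B′ ∣ A′ ∣ C′ ⟫
    ∼-swap₀₁ = ∼-permute σ₀₁ σ₀₁-involutive swapped swapped
      where
      swapped : ∀ {A B C} s → ⟪ B ∣ A ∣ C ⟫ s ≡ ⟪ A ∣ B ∣ C ⟫ (σ₀₁ s)
      swapped zero = refl
      swapped (suc zero) = refl
      swapped (suc (suc zero)) = refl

    ∼-swap₁₂ : ∀ {A B C A′ B′ C′} → ⟪ A ∣ B ∣ C ⟫ ∼ ⟪ A′ ∣ B′ ∣ C′ ⟫ → ⟪ A ∣ C ∣ B ⟫ ∼ ⟪ A′ ∣ C′ ∣ B′ ⟫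
    ∼-swap₁₂ = ∼-permute σ₁₂ σ₁₂-involutive swapped swapped
      where
      swapped : ∀ {A B C} s → ⟪ A ∣ C ∣ B ⟫ s ≡ ⟪ A ∣ B ∣ C ⟫ (σ₁₂ s)
      swapped zero = refl
      swapped (suc zero) = refl
      swapped (suc (suc zero)) = refl

    private
      swapped-top : ∀ {x y} O {u v u′ v′} → top O ≡ (u , v) → swapAlt x y u ≡ u′ → swapAlt x y v ≡ v′ →
        top (swapOrdering x y O) ≡ (u′ , v′)
      swapped-top {x} {y} O top≡ refl refl = top-swapOrdering x y O top≡

    -- Individual s ranks a, x, y on
    -- top, so its top pair {x, a} becomes {y, a}; individual w ranks y just above x
    -- in places 3–4 below {c, d}, in places 1–2, or in places 2–3 below b.
    replace-disjoint : ∀ {t s w x y a c d} → s ≢ w → t s ≈ (x , a) → t w ≈ (c , d) →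
      a ≢ x → a ≢ y → x ≢ y → c ≢ d → (c , d) # (x , y) → t ∼ t [ s ≔ (y , a) ]
    replace-disjoint {t} {s} {w} {x} {y} {a} {c} {d} s≢w tₛ≈xa tᵥ≈cd a≢x a≢y x≢y c≢d ((x≢c , x≢d) , (y≢c , y≢d)) =
      equivalent λ τ → Ψ-transposition τ Oₛ Oᵥ s≢w (ordering₃-above a x y x≢y) (ordering₄-above c d y x (x≢y ∘ sym))
        (≈-trans (≡⇒≈ Oₛ-top) (≈-trans ≈-swap (≈-sym tₛ≈xa)))
        (≈-trans (≡⇒≈ Oᵥ-top) (≈-sym tᵥ≈cd))
        (≈-trans (≡⇒≈ (swapped-top Oₛ Oₛ-top (swapAlt-other a≢x a≢y) (swapAlt-left x y)))
                 (≈-trans ≈-swap (≡⇒≈ (sym ([≔]-updates t s (y , a))))))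
        (≈-trans (≡⇒≈ (swapped-top Oᵥ Oᵥ-top (swapAlt-other (x≢c ∘ sym) (y≢c ∘ sym))
                                             (swapAlt-other (x≢d ∘ sym) (y≢d ∘ sym))))
                 (≈-trans (≈-sym tᵥ≈cd) (≡⇒≈ (sym ([≔]-minimal t (y , a) (s≢w ∘ sym))))))
        (λ r r≢s _ → [≔]-minimal t (y , a) r≢s)
      where
      Oₛ Oᵥ : Ordering (4 + k)
      Oₛ = ordering₃ a x y
      Oᵥ = ordering₄ c d y x
      Oₛ-top : top Oₛ ≡ (a , x)
      Oₛ-top = ordering₃-top a x y a≢x a≢y x≢y
      Oᵥ-top : top Oᵥ ≡ (c , d)
      Oᵥ-top = ordering₄-top c d y x c≢d (y≢c ∘ sym) (x≢c ∘ sym) (y≢d ∘ sym) (x≢d ∘ sym)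

    replace-matching : ∀ {t s w x y a} → s ≢ w → t s ≈ (x , a) → t w ≈ (y , x) →
      a ≢ x → a ≢ y → x ≢ y → t ∼ t [ s ≔ (y , a) ]
    replace-matching {t} {s} {w} {x} {y} {a} s≢w tₛ≈xa tᵥ≈yx a≢x a≢y x≢y =
      equivalent λ τ → Ψ-transposition τ Oₛ Oᵥ s≢w (ordering₃-above a x y x≢y) (ordering₂-above y x (x≢y ∘ sym))
        (≈-trans (≡⇒≈ Oₛ-top) (≈-trans ≈-swap (≈-sym tₛ≈xa)))
        (≈-trans (≡⇒≈ Oᵥ-top) (≈-sym tᵥ≈yx))
        (≈-trans (≡⇒≈ (swapped-top Oₛ Oₛ-top (swapAlt-other a≢x a≢y) (swapAlt-left x y)))
                 (≈-trans ≈-swap (≡⇒≈ (sym ([≔]-updates t s (y , a))))))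
        (≈-trans (≡⇒≈ (swapped-top Oᵥ Oᵥ-top (swapAlt-right x y) (swapAlt-left x y)))
                 (≈-trans ≈-swap (≈-trans (≈-sym tᵥ≈yx) (≡⇒≈ (sym ([≔]-minimal t (y , a) (s≢w ∘ sym)))))))
        (λ r r≢s _ → [≔]-minimal t (y , a) r≢s)
      where
      Oₛ Oᵥ : Ordering (4 + k)
      Oₛ = ordering₃ a x y
      Oᵥ = ordering₂ y x
      Oₛ-top : top Oₛ ≡ (a , x)
      Oₛ-top = ordering₃-top a x y a≢x a≢y x≢y
      Oᵥ-top : top Oᵥ ≡ (y , x)
      Oᵥ-top = ordering₂-top y x (x≢y ∘ sym)

    exchange : ∀ {t s w x y a b} → s ≢ w → t s ≈ (x , a) → t w ≈ (y , b) →
      a ≢ x → a ≢ y → b ≢ x → b ≢ y → x ≢ y → t ∼ t [ s ≔ (y , a) ] [ w ≔ (x , b) ]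
    exchange {t} {s} {w} {x} {y} {a} {b} s≢w tₛ≈xa tᵥ≈yb a≢x a≢y b≢x b≢y x≢y =
      equivalent λ τ → Ψ-transposition τ Oₛ Oᵥ s≢w (ordering₃-above a x y x≢y) (ordering₃-above b y x (x≢y ∘ sym))
        (≈-trans (≡⇒≈ Oₛ-top) (≈-trans ≈-swap (≈-sym tₛ≈xa)))
        (≈-trans (≡⇒≈ Oᵥ-top) (≈-trans ≈-swap (≈-sym tᵥ≈yb)))
        (≈-trans (≡⇒≈ (swapped-top Oₛ Oₛ-top (swapAlt-other a≢x a≢y) (swapAlt-left x y)))
                 (≈-trans ≈-swap (≡⇒≈ (sym (trans ([≔]-minimal _ (x , b) s≢w) ([≔]-updates t s (y , a)))))))
        (≈-trans (≡⇒≈ (swapped-top Oᵥ Oᵥ-top (swapAlt-other b≢x b≢y) (swapAlt-right x y)))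
                 (≈-trans ≈-swap (≡⇒≈ (sym ([≔]-updates _ w (x , b))))))
        (λ r r≢s r≢w → trans ([≔]-minimal _ (x , b) r≢w) ([≔]-minimal t (y , a) r≢s))
      where
      Oₛ Oᵥ : Ordering (4 + k)
      Oₛ = ordering₃ a x y
      Oᵥ = ordering₃ b y x
      Oₛ-top : top Oₛ ≡ (a , x)
      Oₛ-top = ordering₃-top a x y a≢x a≢y x≢y
      Oᵥ-top : top Oᵥ ≡ (b , y)
      Oᵥ-top = ordering₃-top b y x b≢y b≢x (x≢y ∘ sym)

    -- Normal form of mixed configurations

    open SetoidReasoning configurations

    Normal : Configuration → Set
    Normal t = t ∼ canonical

    module _ {a b c d : X} (D : Distinct₄ a b c d) where
      open Distinct₄ D

      twin-rename₁ : ∀ {b′} → b′ ≢ a → b′ ≢ c → b′ ≢ d → twin (a , b) (c , d) ∼ twin (a , b′) (c , d)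
      twin-rename₁ {b′} b′≢a b′≢c b′≢d with b′ ≟ b
      ... | yes refl = ∼-refl
      ... | no b′≢b = begin
        twin (a , b) (c , d)   ≈⟨ replace-disjoint {s = # 0} {w = # 1} (λ ()) ≈-swap ≈-refl
                                    (a≢b) (b′≢a ∘ sym) (b′≢b ∘ sym) c≢d ((b≢c , b≢d) , (b′≢c , b′≢d)) ⟩
        twin (b′ , a) (c , d)  ≈⟨ ∼-cong ≈-swap ≈-refl ≈-refl ⟩
        twin (a , b′) (c , d)  ∎

      twin-rename₂ : ∀ {c′} → c′ ≢ a → c′ ≢ b → c′ ≢ d → twin (a , b) (c , d) ∼ twin (a , b) (c′ , d)
      twin-rename₂ {c′} c′≢a c′≢b c′≢d with c′ ≟ c
      ... | yes refl = ∼-refl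
      ... | no c′≢c = begin
        ⟪ (a , b) ∣ (c , d) ∣ (c , d) ⟫    ≈⟨ replace-disjoint {s = # 1} {w = # 0} (λ ()) ≈-refl ≈-refl
                                               (c≢d ∘ sym) (c′≢d ∘ sym) (c′≢c ∘ sym) a≢b off ⟩
        ⟪ (a , b) ∣ (c′ , d) ∣ (c , d) ⟫   ≈⟨ replace-disjoint {s = # 2} {w = # 0} (λ ()) ≈-refl ≈-refl
                                               (c≢d ∘ sym) (c′≢d ∘ sym) (c′≢c ∘ sym) a≢b off ⟩
        ⟪ (a , b) ∣ (c′ , d) ∣ (c′ , d) ⟫  ∎
        where
        off : (a , b) # (c , c′)
        off = ((a≢c ∘ sym) , (b≢c ∘ sym)) , (c′≢a , c′≢b)

      twin-exchange : twin (a , b) (c , d) ∼ twin (a , c) (b , d)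
      twin-exchange = begin
        ⟪ (a , b) ∣ (c , d) ∣ (c , d) ⟫  ≈⟨ exchange {s = # 0} {w = # 1} (λ ()) ≈-refl ≈-refl
                                             (a≢b ∘ sym) b≢c (a≢d ∘ sym) (c≢d ∘ sym) a≢c ⟩
        ⟪ (c , b) ∣ (a , d) ∣ (c , d) ⟫  ≈⟨ replace-matching {s = # 2} {w = # 0} (λ ()) ≈-refl ≈-swap
                                             (c≢d ∘ sym) (b≢d ∘ sym) (b≢c ∘ sym) ⟩
        ⟪ (c , b) ∣ (a , d) ∣ (b , d) ⟫  ≈⟨ exchange {s = # 0} {w = # 1} (λ ()) ≈-swap ≈-refl
                                             (b≢c ∘ sym) (a≢c ∘ sym) (b≢d ∘ sym) (a≢d ∘ sym) (a≢b ∘ sym) ⟩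
        ⟪ (a , c) ∣ (b , d) ∣ (b , d) ⟫  ∎

      swap-twins : ⟪ (a , b) ∣ (c , d) ∣ (a , b) ⟫ ∼ twin (c , d) (a , b)
      swap-twins = begin
        ⟪ (a , b) ∣ (c , d) ∣ (a , b) ⟫  ≈⟨ exchange {s = # 0} {w = # 1} (λ ()) ≈-refl ≈-refl
                                             (a≢b ∘ sym) b≢c (a≢d ∘ sym) (c≢d ∘ sym) a≢c ⟩
        ⟪ (c , b) ∣ (a , d) ∣ (a , b) ⟫  ≈⟨ exchange {s = # 0} {w = # 1} (λ ()) ≈-swap ≈-swap
                                             (b≢c ∘ sym) (c≢d) a≢b (a≢d) (b≢d) ⟩
        ⟪ (d , c) ∣ (b , a) ∣ (a , b) ⟫  ≈⟨ ∼-cong ≈-swap ≈-swap ≈-refl ⟩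
        ⟪ (c , d) ∣ (a , b) ∣ (a , b) ⟫  ∎

    twin-put₁ : ∀ {a b c d v} → Distinct₄ a b c d → v ≢ a →
      ∃₂ λ c′ d′ → Distinct₄ a v c′ d′ × twin (a , b) (c , d) ∼ twin (a , v) (c′ , d′)
    twin-put₁ {a} {b} {c} {d} {v} D v≢a with v ≟ b | v ≟ c | v ≟ d
    ... | yes refl | _ | _ = c , d , D , ∼-refl
    ... | no _ | yes refl | _ = b , d , distinct₄-swap₁₂ D , twin-exchange D
    ... | no _ | no _ | yes refl = b , c , distinct₄-swap₁₂ (distinct₄-swap₂₃ D) ,
          ∼-trans (∼-cong ≈-refl ≈-swap ≈-swap) (twin-exchange (distinct₄-swap₂₃ D))
    ... | no v≢b | no v≢c | no v≢d = c , d , distinct₄ (v≢a ∘ sym) a≢c a≢d v≢c v≢d c≢d ,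
          twin-rename₁ D v≢a v≢c v≢d
      where open Distinct₄ D

    twin-put₀ : ∀ {a b c d} → Distinct₄ a b c d →
      ∃₂ λ b′ c′ → ∃ λ d′ → Distinct₄ (# 0) b′ c′ d′ × twin (a , b) (c , d) ∼ twin (# 0 , b′) (c′ , d′)
    twin-put₀ {a} {b} {c} {d} D with a ≟ # 0
    ... | yes refl = b , c , d , D , ∼-refl
    ... | no a≢0 with twin-put₁ D (a≢0 ∘ sym)
    ...   | c′ , d′ , D′ , ab∼a0 = a , c′ , d′ , distinct₄-swap₀₁ D′ , ∼-trans ab∼a0 (∼-cong ≈-swap ≈-refl ≈-refl)

    twin-put₂ : ∀ {a b c d v} → Distinct₄ a b c d → v ≢ a → v ≢ b →
      ∃ λ d′ → Distinct₄ a b v d′ × twin (a , b) (c , d) ∼ twin (a , b) (v , d′)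
    twin-put₂ {a} {b} {c} {d} {v} D v≢a v≢b with v ≟ c | v ≟ d
    ... | yes refl | _ = d , D , ∼-refl
    ... | no _ | yes refl = c , distinct₄-swap₂₃ D , ∼-cong ≈-refl ≈-swap ≈-swap
    ... | no v≢c | no v≢d = d , distinct₄ a≢b (v≢a ∘ sym) a≢d (v≢b ∘ sym) b≢d v≢d , twin-rename₂ D v≢a v≢b v≢d
      where open Distinct₄ D

    twin-put₃ : ∀ {a b c d v} → Distinct₄ a b c d → v ≢ a → v ≢ b → v ≢ c →
      twin (a , b) (c , d) ∼ twin (a , b) (c , v)
    twin-put₃ {a} {b} {c} {d} {v} D v≢a v≢b v≢c = begin
      twin (a , b) (c , d)  ≈⟨ ∼-cong ≈-refl ≈-swap ≈-swap ⟩
      twin (a , b) (d , c)  ≈⟨ twin-rename₂ (distinct₄-swap₂₃ D) v≢a v≢b v≢c ⟩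
      twin (a , b) (v , c)  ≈⟨ ∼-cong ≈-refl ≈-swap ≈-swap ⟩
      twin (a , b) (c , v)  ∎

    -- With four alternatives there may be no fresh one to rename to, so positions
    -- are permuted as well.
    twin-normal : ∀ {a b c d} → Distinct₄ a b c d → Normal (twin (a , b) (c , d))
    twin-normal {a} {b} {c} {d} D with twin-put₀ D
    ... | b₁ , c₁ , d₁ , D₁ , eq₁ with twin-put₁ D₁ (λ ())
    ... | c₂ , d₂ , D₂ , eq₂ with twin-put₂ D₂ (λ ()) (λ ())
    ... | d₃ , D₃ , eq₃ = begin
      twin (a , b) (c , d)          ≈⟨ eq₁ ⟩
      twin (# 0 , b₁) (c₁ , d₁)     ≈⟨ eq₂ ⟩
      twin (# 0 , # 1) (c₂ , d₂)    ≈⟨ eq₃ ⟩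
      twin (# 0 , # 1) (# 2 , d₃)   ≈⟨ twin-put₃ D₃ (λ ()) (λ ()) (λ ()) ⟩
      twin (# 0 , # 1) (# 2 , # 3)  ∎

    normal-swap₀₁ : ∀ {A B C} → Normal ⟪ A ∣ B ∣ C ⟫ → Normal ⟪ B ∣ A ∣ C ⟫
    normal-swap₀₁ normal = ∼-trans (∼-swap₀₁ normal)
      (swap-twins (distinct₄ (λ ()) (λ ()) (λ ()) (λ ()) (λ ()) (λ ())))

    normal-swap₁₂ : ∀ {A B C} → Normal ⟪ A ∣ B ∣ C ⟫ → Normal ⟪ A ∣ C ∣ B ⟫
    normal-swap₁₂ = ∼-swap₁₂

    straddle-normal : ∀ {a b c d} → Distinct₄ a b c d → Normal ⟪ (a , b) ∣ (c , d) ∣ (a , c) ⟫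
    straddle-normal {a} {b} {c} {d} D = begin
      ⟪ (a , b) ∣ (c , d) ∣ (a , c) ⟫  ≈⟨ exchange {s = # 0} {w = # 1} (λ ()) ≈-refl ≈-swap
                                           (a≢b ∘ sym) b≢d (a≢c ∘ sym) (c≢d) a≢d ⟩
      twin (d , b) (a , c)             ≈⟨ twin-normal
                                           (distinct₄ (b≢d ∘ sym) (a≢d ∘ sym) (c≢d ∘ sym) (a≢b ∘ sym) b≢c a≢c) ⟩
      canonical                        ∎
      where open Distinct₄ D

    relocate-step : ∀ {W B x y a} → Proper W → W # (x , y) → a ≢ x → a ≢ y →
      ⟪ W ∣ B ∣ (x , a) ⟫ ∼ ⟪ W ∣ B ∣ (y , a) ⟫
    relocate-step {x = x} {y} W-proper W#xy a≢x a≢y with x ≟ y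
    ... | yes refl = ∼-refl
    ... | no x≢y = replace-disjoint {s = # 2} {w = # 0} (λ ()) ≈-refl ≈-refl a≢x a≢y x≢y W-proper W#xy

    relocate : ∀ {W B C D} → Proper W → W # C → W # D → Proper C → Proper D →
      ⟪ W ∣ B ∣ C ⟫ ∼ ⟪ W ∣ B ∣ D ⟫
    relocate {W} {B} {e , f} {g , h} W-proper (e∉W , f∉W) (g∉W , h∉W) e≢f g≢h with g ≟ f
    ... | yes refl = begin
      ⟪ W ∣ B ∣ (e , g) ⟫  ≈⟨ relocate-step W-proper (e∉W , h∉W) (e≢f ∘ sym) g≢h ⟩
      ⟪ W ∣ B ∣ (h , g) ⟫  ≈⟨ ∼-cong ≈-refl ≈-refl ≈-swap ⟩
      ⟪ W ∣ B ∣ (g , h) ⟫  ∎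
    ... | no g≢f = begin
      ⟪ W ∣ B ∣ (e , f) ⟫  ≈⟨ relocate-step W-proper (e∉W , g∉W) (e≢f ∘ sym) (g≢f ∘ sym) ⟩
      ⟪ W ∣ B ∣ (g , f) ⟫  ≈⟨ ∼-cong ≈-refl ≈-refl ≈-swap ⟩
      ⟪ W ∣ B ∣ (f , g) ⟫  ≈⟨ relocate-step W-proper (f∉W , h∉W) g≢f g≢h ⟩
      ⟪ W ∣ B ∣ (h , g) ⟫  ≈⟨ ∼-cong ≈-refl ≈-refl ≈-swap ⟩
      ⟪ W ∣ B ∣ (g , h) ⟫  ∎

    disjoint-normal : ∀ {a b c d C} → Distinct₄ a b c d → Proper C → Normal ⟪ (a , b) ∣ (c , d) ∣ C ⟫
    disjoint-normal {a} {b} {c} {d} {C} D C-proper with placement C (distinct₄⇒# D)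
    ... | apart-from-first A#C = begin
      ⟪ (a , b) ∣ (c , d) ∣ C ⟫  ≈⟨ relocate a≢b A#C (distinct₄⇒# D) C-proper c≢d ⟩
      twin (a , b) (c , d)       ≈⟨ twin-normal D ⟩
      canonical                  ∎
      where open Distinct₄ D
    ... | apart-from-second B#C = normal-swap₀₁ (begin
      ⟪ (c , d) ∣ (a , b) ∣ C ⟫  ≈⟨ relocate c≢d B#C (distinct₄⇒# (distinct₄-blocks D)) C-proper a≢b ⟩
      twin (c , d) (a , b)       ≈⟨ twin-normal (distinct₄-blocks D) ⟩
      canonical                  ∎)
      where open Distinct₄ D
    ... | straddling A≈ B≈ C≈ = ∼-trans (∼-cong A≈ B≈ C≈) (straddle-normal (distinct₄-≈ A≈ B≈ D))

    triangle-normal : ∀ {a b c} → a ≢ b → a ≢ c → b ≢ c → Normal ⟪ (a , b) ∣ (a , c) ∣ (b , c) ⟫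
    triangle-normal {a} {b} {c} a≢b a≢c b≢c with fourth a b c
    ... | d , d≢a , d≢b , d≢c = begin
      ⟪ (a , b) ∣ (a , c) ∣ (b , c) ⟫  ≈⟨ replace-disjoint {s = # 0} {w = # 2} (λ ()) ≈-refl ≈-refl
                                           (a≢b ∘ sym) (d≢b ∘ sym) (d≢a ∘ sym) b≢c ((a≢b , a≢c) , (d≢b , d≢c)) ⟩
      ⟪ (d , b) ∣ (a , c) ∣ (b , c) ⟫  ≈⟨ disjoint-normal (distinct₄ d≢b d≢a d≢c (a≢b ∘ sym) b≢c a≢c) b≢c ⟩
      canonical                        ∎

    adjacent-normal : ∀ {a b c C} → a ≢ b → a ≢ c → b ≢ c → Proper C → Normal ⟪ (a , b) ∣ (a , c) ∣ C ⟫
    adjacent-normal {a} {b} {c} {C} a≢b a≢c b≢c C-proper with locate a C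
    ... | inj₁ (g , C≈ag) = ∼-trans (∼-cong ≈-refl ≈-refl C≈ag) (through-a (≈-proper C≈ag C-proper))
      where
      through-a : ∀ {g} → a ≢ g → Normal ⟪ (a , b) ∣ (a , c) ∣ (a , g) ⟫
      through-a {g} a≢g with g ≟ b | g ≟ c
      ... | yes refl | _ = begin
        ⟪ (a , g) ∣ (a , c) ∣ (a , g) ⟫  ≈⟨ replace-matching {s = # 2} {w = # 1} (λ ()) ≈-refl ≈-swap
                                             (a≢g ∘ sym) b≢c a≢c ⟩
        ⟪ (a , g) ∣ (a , c) ∣ (c , g) ⟫  ≈⟨ ∼-cong ≈-refl ≈-refl ≈-swap ⟩
        ⟪ (a , g) ∣ (a , c) ∣ (g , c) ⟫  ≈⟨ triangle-normal a≢b a≢c b≢c ⟩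
        canonical                        ∎
      ... | no _ | yes refl = begin
        ⟪ (a , b) ∣ (a , g) ∣ (a , g) ⟫  ≈⟨ replace-matching {s = # 2} {w = # 0} (λ ()) ≈-refl ≈-swap
                                             (a≢g ∘ sym) (b≢c ∘ sym) a≢b ⟩
        ⟪ (a , b) ∣ (a , g) ∣ (b , g) ⟫  ≈⟨ triangle-normal a≢b a≢c b≢c ⟩
        canonical                        ∎
      ... | no g≢b | no g≢c = begin
        ⟪ (a , b) ∣ (a , c) ∣ (a , g) ⟫  ≈⟨ replace-matching {s = # 2} {w = # 0} (λ ()) ≈-refl ≈-swap
                                             (a≢g ∘ sym) g≢b a≢b ⟩
        ⟪ (a , b) ∣ (a , c) ∣ (b , g) ⟫  ≈⟨ normal-swap₀₁ (normal-swap₁₂ (disjoint-normal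
                                             (distinct₄ a≢c a≢b a≢g (b≢c ∘ sym) (g≢c ∘ sym) (g≢b ∘ sym)) a≢b)) ⟩
        canonical                        ∎
    ... | inj₂ a∉C with locate b C | locate c C
    ...   | inj₂ b∉C | _ = normal-swap₁₂ (disjoint-normal (#⇒distinct₄ a≢b C-proper (#-intro a∉C b∉C)) a≢c)
    ...   | inj₁ _ | inj₂ c∉C =
            normal-swap₀₁ (normal-swap₁₂ (disjoint-normal (#⇒distinct₄ a≢c C-proper (#-intro a∉C c∉C)) a≢b))
    ...   | inj₁ (z , C≈bz) | inj₁ (_ , C≈cz′) =
            ∼-trans (∼-cong ≈-refl ≈-refl (subst (λ z → C ≈ (b , z)) (second-of (≈-trans (≈-sym C≈bz) C≈cz′)) C≈bz))
                    (triangle-normal a≢b a≢c b≢c)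
      where
      second-of : ∀ {z z′} → (b , z) ≈ (c , z′) → z ≡ c
      second-of ≈-refl = ⊥-elim (b≢c refl)
      second-of ≈-swap = refl

    distinct-normal : ∀ {A B C} → Proper A → Proper B → Proper C → A ≉ B → Normal ⟪ A ∣ B ∣ C ⟫
    distinct-normal {a , b} {B} {C} a≢b B-proper C-proper A≉B with locate a B
    ... | inj₁ (c , B≈ac) =
          ∼-trans (∼-cong ≈-refl B≈ac ≈-refl) (adjacent-normal a≢b (≈-proper B≈ac B-proper) b≢c C-proper)
      where
      b≢c : b ≢ c
      b≢c refl = A≉B (≈-sym B≈ac)
    ... | inj₂ a∉B with locate b B
    ...   | inj₁ (c , B≈bc) = ∼-trans (∼-cong ≈-swap B≈bc ≈-refl)
            (adjacent-normal (a≢b ∘ sym) (≈-proper B≈bc B-proper) (proj₂ (∉ₚ-cong B≈bc a∉B)) C-proper)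
    ...   | inj₂ b∉B = disjoint-normal (#⇒distinct₄ a≢b B-proper (#-intro a∉B b∉B)) C-proper

    mixed-normal : ∀ {A B C} → Proper A → Proper B → Proper C → A ≉ B ⊎ A ≉ C → Normal ⟪ A ∣ B ∣ C ⟫
    mixed-normal A-proper B-proper C-proper (inj₁ A≉B) = distinct-normal A-proper B-proper C-proper A≉B
    mixed-normal A-proper B-proper C-proper (inj₂ A≉C) =
      normal-swap₁₂ (distinct-normal A-proper C-proper B-proper A≉C)

    fill-proper : ∀ τ {t} → (∀ s → Proper (t s)) → (∀ l → Proper (p l)) → ∀ l → Proper (fill τ t l)
    fill-proper τ t-proper p-proper l with any? (λ s → member τ s ≟ l)
    ... | yes (s , _) = t-proper s
    ... | no _ = p-proper l

    Ψ-fill : ∀ τ t q → (∀ s → q (member τ s) ≡ t s) → (∀ l → (∀ s → member τ s ≢ l) → q l ≡ p l) → Ψ τ t ≡ F q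
    Ψ-fill τ t q q-on q-off = F-cong λ l → ≡⇒≈ (fill≡q l)
      where
      fill≡q : ∀ l → fill τ t l ≡ q l
      fill≡q l with any? (λ s → member τ s ≟ l)
      ... | yes (s , refl) = sym (q-on s)
      ... | no l∉τ = sym (q-off l λ s τs≡l → l∉τ (s , τs≡l))

  open Background using (Ψ; Ψ-fill; Ψ-equal; fill; fill-member; fill-proper; mixed-normal)

  i₀ i₁ i₂ : I
  i₀ = # 0
  i₁ = # 1
  i₂ = # 2

  trio : (i j l : I) → i ≢ j → i ≢ l → j ≢ l → Trio
  trio i j l i≢j i≢l j≢l = mk↣ {to = i ∷ j ∷ l ∷ []} injective
    where
    injective : Injective _≡_ _≡_ (i ∷ j ∷ l ∷ [])
    injective {zero} {zero} _ = refl
    injective {zero} {suc zero} e = ⊥-elim (i≢j e)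
    injective {zero} {suc (suc zero)} e = ⊥-elim (i≢l e)
    injective {suc zero} {zero} e = ⊥-elim (i≢j (sym e))
    injective {suc zero} {suc zero} _ = refl
    injective {suc zero} {suc (suc zero)} e = ⊥-elim (j≢l e)
    injective {suc (suc zero)} {zero} e = ⊥-elim (i≢l (sym e))
    injective {suc (suc zero)} {suc zero} e = ⊥-elim (j≢l (sym e))
    injective {suc (suc zero)} {suc (suc zero)} _ = refl

  -- Sweeping the remaining individuals

  standard : PairProfile
  standard = (λ _ → U) [ i₀ ≔ T ]

  Settled : PairProfile → Set
  Settled q = q i₀ ≡ T × q i₁ ≡ U × (∀ l → Proper (q l))

  standard-i₀ : standard i₀ ≡ T
  standard-i₀ = [≔]-updates (λ _ → U) i₀ T

  standard-other : ∀ l → l ≢ i₀ → standard l ≡ U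
  standard-other l l≢i₀ = [≔]-minimal _ T l≢i₀

  standard-proper : ∀ l → Proper (standard l)
  standard-proper = [≔]-pointwise Proper {xs = λ _ → U} {i₀} {T} (λ _ ()) (λ ())

  settled-update : ∀ {q} l → Settled q → Settled (q [ l ≔ standard l ])
  settled-update {q} l (q₀ , q₁ , q-proper) =
    agree q₀ standard-i₀ , agree q₁ (standard-other i₁ (λ ())) ,
    [≔]-pointwise Proper {xs = q} {l} {standard l} q-proper (standard-proper l)
    where
    agree : ∀ {j v} → q j ≡ v → standard j ≡ v → (q [ l ≔ standard l ]) j ≡ v
    agree {j} qⱼ≡v standardⱼ≡v with j ≟ l
    ... | yes refl = trans ([≔]-updates q j (standard j)) standardⱼ≡v
    ... | no j≢l = trans ([≔]-minimal q (standard l) j≢l) qⱼ≡v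

  -- Individuals 0 and 1 hold the different pairs T and U, so every triple through
  -- them is mixed.
  settled-step : ∀ {q} l → Settled q → F q ≡ F (q [ l ≔ standard l ])
  settled-step {q} l (q₀ , q₁ , q-proper) with l ≟ i₀ | l ≟ i₁
  ... | yes refl | _ = F-cong (≡⇒≈ ∘ sym ∘ [≔]-idle q (trans q₀ (sym standard-i₀)))
  ... | _ | yes refl = F-cong (≡⇒≈ ∘ sym ∘ [≔]-idle q (trans q₁ (sym (standard-other i₁ (λ ())))))
  ... | no l≢i₀ | no l≢i₁ = begin
    F q                        ≡⟨ Ψ-fill q τ ⟪ T ∣ U ∣ q l ⟫ q on-q (λ _ _ → refl) ⟨
    Ψ q τ ⟪ T ∣ U ∣ q l ⟫      ≡⟨ Ψ-equal (mixed-normal q (λ ()) (λ ()) (q-proper l) (inj₁ T≉U)) τ ⟩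
    Ψ q τ ⟪ T ∣ U ∣ U ⟫        ≡⟨ Ψ-fill q τ ⟪ T ∣ U ∣ U ⟫ (q [ l ≔ standard l ]) on-q′ off-q′ ⟩
    F (q [ l ≔ standard l ])   ∎
    where
    open ≡-Reasoning
    τ : Trio
    τ = trio i₀ i₁ l (λ ()) (l≢i₀ ∘ sym) (l≢i₁ ∘ sym)
    on-q : ∀ s → q (member τ s) ≡ ⟪ T ∣ U ∣ q l ⟫ s
    on-q zero = q₀
    on-q (suc zero) = q₁
    on-q (suc (suc zero)) = refl
    on-q′ : ∀ s → (q [ l ≔ standard l ]) (member τ s) ≡ ⟪ T ∣ U ∣ U ⟫ s
    on-q′ zero = trans ([≔]-minimal q (standard l) (l≢i₀ ∘ sym)) q₀
    on-q′ (suc zero) = trans ([≔]-minimal q (standard l) (l≢i₁ ∘ sym)) q₁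
    on-q′ (suc (suc zero)) = trans ([≔]-updates q l (standard l)) (standard-other l l≢i₀)
    off-q′ : ∀ r → (∀ s → member τ s ≢ r) → (q [ l ≔ standard l ]) r ≡ q r
    off-q′ r r∉τ = [≔]-minimal q (standard l) (r∉τ (# 2) ∘ sym)

  settled-standard : ∀ {q} → Settled q → F q ≡ F standard
  settled-standard = converge F (λ q≡q′ → F-cong (≡⇒≈ ∘ q≡q′)) standard Settled settled-update settled-step

  mixed-standard : ∀ {q} → (∀ l → Proper (q l)) → ∀ l → l ≢ i₀ → l ≢ i₁ →
    q i₀ ≉ q i₁ ⊎ q i₀ ≉ q l → F q ≡ F standard
  mixed-standard {q} q-proper l l≢i₀ l≢i₁ mixed = begin
    F q                            ≡⟨ Ψ-fill q τ ⟪ q i₀ ∣ q i₁ ∣ q l ⟫ q on-q (λ _ _ → refl) ⟨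
    Ψ q τ ⟪ q i₀ ∣ q i₁ ∣ q l ⟫    ≡⟨ Ψ-equal (mixed-normal q (q-proper i₀) (q-proper i₁) (q-proper l) mixed) τ ⟩
    F (fill q τ canonical)         ≡⟨ settled-standard settled ⟩
    F standard                     ∎
    where
    open ≡-Reasoning
    τ : Trio
    τ = trio i₀ i₁ l (λ ()) (l≢i₀ ∘ sym) (l≢i₁ ∘ sym)
    on-q : ∀ s → q (member τ s) ≡ ⟪ q i₀ ∣ q i₁ ∣ q l ⟫ s
    on-q zero = refl
    on-q (suc zero) = refl
    on-q (suc (suc zero)) = refl
    settled : Settled (fill q τ canonical)
    settled = fill-member q τ canonical {zero} refl , fill-member q τ canonical {suc zero} refl ,
              fill-proper q τ canonical-proper q-proper

  disagreement-standard : ∀ {q} → (∀ l → Proper (q l)) → ∀ {a b} → q a ≉ q b → F q ≡ F standard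
  disagreement-standard {q} q-proper {a} {b} qa≉qb with q i₀ ≈? q i₁ | q a ≈? q i₀
  ... | no q₀≉q₁ | _ = mixed-standard q-proper i₂ (λ ()) (λ ()) (inj₁ q₀≉q₁)
  ... | yes q₀≈q₁ | no qa≉q₀ = mixed-standard q-proper a a≢i₀ a≢i₁ (inj₂ (qa≉q₀ ∘ ≈-sym))
    where
    a≢i₀ : a ≢ i₀
    a≢i₀ refl = qa≉q₀ ≈-refl
    a≢i₁ : a ≢ i₁
    a≢i₁ refl = qa≉q₀ (≈-sym q₀≈q₁)
  ... | yes q₀≈q₁ | yes qa≈q₀ = mixed-standard q-proper b b≢i₀ b≢i₁ (inj₂ q₀≉qb)
    where
    q₀≉qb : q i₀ ≉ q b
    q₀≉qb q₀≈qb = qa≉qb (≈-trans qa≈q₀ q₀≈qb)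
    b≢i₀ : b ≢ i₀
    b≢i₀ refl = q₀≉qb ≈-refl
    b≢i₁ : b ≢ i₁
    b≢i₁ refl = q₀≉qb q₀≈q₁

  disagreement : ∀ u → InD u → ∃₂ λ (a b : I) → top (u a) ≉ top (u b)
  disagreement u u∈D with all? (λ a → all? (λ b → top (u a) ≈? top (u b)))
  ... | yes unanimous = ⊥-elim (u∈D λ a b → ≈⇒SameTop2 (u a) (u b) (unanimous a b))
  ... | no ¬unanimous with ¬∀⟶∃¬ _ _ (λ a → all? (λ b → top (u a) ≈? top (u b))) ¬unanimous
  ...   | a , ¬all with ¬∀⟶∃¬ _ _ (λ b → top (u a) ≈? top (u b)) ¬all
  ...     | b , tops≉ = a , b , tops≉

  chosen-standard : ∀ u → InD u → chosen G u ≡ F standard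
  chosen-standard u u∈D with disagreement u u∈D
  ... | a , b , tops≉ = trans (chosen≡F u) (disagreement-standard {top ∘ u} (top-proper ∘ u) {a} {b} tops≉)

theorem3 : (m n : ℕ) → 4 ≤ m → 3 ≤ n → (G : SCC m n) →
    Balanced G → Top2Only G →
    (u v : Profile m n) → InD u → InD v → chosen G u ≡ chosen G v
theorem3 (suc (suc (suc (suc k)))) (suc (suc (suc n′))) (s≤s (s≤s (s≤s (s≤s z≤n)))) (s≤s (s≤s (s≤s z≤n)))
  G balanced top2only u v u∈D v∈D = trans (chosen-standard u u∈D) (sym (chosen-standard v v∈D))
  where open Constancy k n′ G balanced top2only
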